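{- Let $H$ be an enumeration operator which is an algebraic closure operator. Then from any computable approximation to $H$ one can effectively find a computable approximation $\{\hat H_s:s\in\omega\}$ to an enumeration operator $\hat H$ such that for every $s$: $X\subseteq\hat H_s(X)$ for every finite $X$ with $\max X\le s$, and $\hat H_s(\hat H_s(X))\subseteq\hat H_s(X)$ for all $X\subseteq\omega$; and moreover $\hat H(X)=H(X)$ for every $X\subseteq\omega$.
   Context: An enumeration operator is a c.e. set $H$ of (codes of) pairs $\langle x,D\rangle$ with $x\in\omega$ and $D$ a finite subset of $\omega$; for $X\subseteq\omega$, $H(X)=\{x:\exists D\subseteq X\ \langle x,D\rangle\in H\}$. $H$ is an algebraic closure operator if $X\subseteq H(X)$ and $H(H(X))\subseteq H(X)$ for all $X\subseteq\omega$. A computable approximation to $H$ is a computable sequence $\{H_s\}_{s\in\omega}$ of finite sets of pairs (given by canonical indices) with $H_s\subseteq H_{s+1}$ and $\bigcup_s H_s=H$; each $H_s$ is viewed as an enumeration operator, $H_s(X)=\{x:\exists D\subseteq X\ \langle x,D\rangle\in H_s\}$. -}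

module Defs where

open import Level using (0ℓ)
open import Data.Nat using (ℕ; _≤_)
open import Data.List using (List)
open import Data.List.Membership.Propositional using (_∈_)
open import Data.List.Relation.Unary.All using (All)
open import Data.Product using (_×_; Σ; ∃; ∃-syntax)
open import Relation.Unary using (Pred; _⊆_)

-- A finite set of pairs ⟨x , D⟩ (D finite), represented by a list
-- (playing the role of a canonical index).
FinOp : Set
FinOp = List (ℕ × List ℕ)

-- A computable approximation: a sequence of finite sets of pairs.
-- (Every Agda function ℕ → FinOp is computable.)
Approx : Set
Approx = ℕ → FinOp

Subset : Set₁
Subset = Pred ℕ 0ℓ

_⊆ᶠ_ : List ℕ → Subset → Set
D ⊆ᶠ X = All (λ d → X d) D

applyFin : FinOp → Subset → Subset
applyFin F X x = ∃[ D ] ((x Data.Product., D) ∈ F × D ⊆ᶠ X)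

HOp : Approx → Subset → Subset
HOp A X x = ∃[ s ] applyFin (A s) X x

Increasing : Approx → Set
Increasing A = ∀ s (p : ℕ × List ℕ) → p ∈ A s → p ∈ A (Data.Nat.suc s)

IsClosureOp : (Subset → Subset) → Set₁
IsClosureOp H = (∀ (X : Subset) → X ⊆ H X) × (∀ (X : Subset) → H (H X) ⊆ H X)

_≐_ : Subset → Subset → Set
X ≐ Y = (X ⊆ Y) × (Y ⊆ X)

listSet : List ℕ → Subset
listSet L x = x ∈ L

MaxLe : List ℕ → ℕ → Set
MaxLe L s = All (_≤ s) L

-- Take Ĥ_s to consist of the pairs ⟨x , D⟩ with D ⊆ [0, s] and x in the closure
-- of D under those axioms ⟨y , E⟩ ∈ H_s with y ≤ s.  This stage closure is
-- decidable: iterating one round of axiom application on the bit vector of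
-- [0, s] only ever adds bits, so it is stable after s + 2 rounds.  Closure of a
-- closure is the closure, which makes every Ĥ_s idempotent.  Since H is a closure
-- operator, the stage closure of D lies in H(D); conversely each axiom of H lies
-- in H_s for every s beyond its stage and all the numbers it mentions.
module Submission where

open import Defs
open import Level using (0ℓ)
open import Data.Bool using (Bool; true; false; T)
open import Data.Empty using (⊥-elim)
open import Data.List using (List; []; _∷_; _++_; map; filter; downFrom; cartesianProduct)
open import Data.List.Extrema.Nat using (max; ⊥≤max; xs≤max)
open import Data.List.Membership.Propositional using (_∈_; find; lose)
open import Data.List.Membership.Propositional.Properties
  using (∈-++⁺ˡ; ∈-++⁺ʳ; ∈-++⁻; ∈-map⁺; ∈-map⁻; ∈-filter⁺; ∈-filter⁻;
         ∈-cartesianProduct⁺; ∈-cartesianProduct⁻; ∈-downFrom⁺; ∈-downFrom⁻)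
open import Data.List.Relation.Unary.All as All using (All; []; _∷_; all?)
open import Data.List.Relation.Unary.All.Properties using (++⁺)
open import Data.List.Relation.Unary.Any using (Any; here; there; any?)
open import Data.Nat using (ℕ; zero; suc; _≤_; _<_; _≤′_; ≤′-refl; ≤′-step; _⊔_; z≤n; s≤s; _≟_)
open import Data.List.Membership.DecPropositional _≟_ using (_∈?_)
open import Data.Nat.GeneralisedArithmetic using (fold)
open import Data.Nat.Properties
  using (≤-trans; m≤n⇒m≤1+n; 1+n≰n; m<1+n⇒m≤n; m≤m⊔n; m≤n⊔m; ≤⇒≤′)
open import Data.Product using (Σ; ∃-syntax; _×_; _,_; proj₁; proj₂)
open import Data.Sum using (_⊎_; inj₁; inj₂; [_,_])
open import Data.Vec using (Vec; []; _∷_)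
open import Function using (_∘_)
open import Relation.Binary.PropositionalEquality using (_≡_; refl; sym; cong; subst)
open import Relation.Nullary.Decidable using (⌊_⌋; does; map′; toWitness; fromWitness; _×-dec_; T?)
open import Relation.Unary using (Pred; Decidable; _⊆_; _∪_)
open import Relation.Unary.Properties using (_∪?_)

bit : ∀ {n} → Vec Bool n → ℕ → Bool
bit []       _       = false
bit (b ∷ _)  zero    = b
bit (_ ∷ bs) (suc x) = bit bs x

⟦_⟧ : ∀ {n} → Vec Bool n → Subset
⟦ bs ⟧ x = T (bit bs x)

⟦_⟧? : ∀ {n} (bs : Vec Bool n) → Decidable ⟦ bs ⟧
⟦ bs ⟧? x = T? (bit bs x)

⟦⟧-bounded : ∀ {n} (bs : Vec Bool n) → ⟦ bs ⟧ ⊆ (_< n)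
⟦⟧-bounded (_ ∷ _)  {zero}  _ = s≤s z≤n
⟦⟧-bounded (_ ∷ bs) {suc x} t = s≤s (⟦⟧-bounded bs t)

characteristic : ∀ {n} {P : Subset} → Decidable P → Vec Bool n
characteristic {zero}  P? = []
characteristic {suc n} P? = ⌊ P? 0 ⌋ ∷ characteristic (P? ∘ suc)

characteristic⁺ : ∀ {n} {P : Subset} (P? : Decidable P) {x} →
                  x < n → P x → ⟦ characteristic {n} P? ⟧ x
characteristic⁺ P? {zero}  (s≤s _)   Px = fromWitness Px
characteristic⁺ {suc n} P? {suc x} (s≤s x<n) Px = characteristic⁺ {n} (P? ∘ suc) x<n Px

characteristic⁻ : ∀ {n} {P : Subset} (P? : Decidable P) → ⟦ characteristic {n} P? ⟧ ⊆ P
characteristic⁻ {suc n} P? {zero}  t = toWitness t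
characteristic⁻ {suc n} P? {suc x} t = characteristic⁻ {n} (P? ∘ suc) t

size : ∀ {n} → Vec Bool n → ℕ
size []           = 0
size (true ∷ bs)  = suc (size bs)
size (false ∷ bs) = size bs

size≤length : ∀ {n} (bs : Vec Bool n) → size bs ≤ n
size≤length []           = z≤n
size≤length (true ∷ bs)  = s≤s (size≤length bs)
size≤length (false ∷ bs) = m≤n⇒m≤1+n (size≤length bs)

⊆⇒size≤ : ∀ {n} (us vs : Vec Bool n) → ⟦ us ⟧ ⊆ ⟦ vs ⟧ → size us ≤ size vs
⊆⇒size≤ []           []           _ = z≤n
⊆⇒size≤ (true ∷ us)  (true ∷ vs)  h = s≤s (⊆⇒size≤ us vs (λ {x} → h {suc x}))
⊆⇒size≤ (true ∷ us)  (false ∷ vs) h = ⊥-elim (h {zero} _)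
⊆⇒size≤ (false ∷ us) (true ∷ vs)  h = m≤n⇒m≤1+n (⊆⇒size≤ us vs (λ {x} → h {suc x}))
⊆⇒size≤ (false ∷ us) (false ∷ vs) h = ⊆⇒size≤ us vs (λ {x} → h {suc x})

⊆⇒≡⊎size< : ∀ {n} (us vs : Vec Bool n) → ⟦ us ⟧ ⊆ ⟦ vs ⟧ → us ≡ vs ⊎ size us < size vs
⊆⇒≡⊎size< []           []           _ = inj₁ refl
⊆⇒≡⊎size< (true ∷ us)  (true ∷ vs)  h with ⊆⇒≡⊎size< us vs (λ {x} → h {suc x})
... | inj₁ us≡vs = inj₁ (cong (true ∷_) us≡vs)
... | inj₂ us<vs = inj₂ (s≤s us<vs)
⊆⇒≡⊎size< (true ∷ us)  (false ∷ vs) h = ⊥-elim (h {zero} _)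
⊆⇒≡⊎size< (false ∷ us) (true ∷ vs)  h = inj₂ (s≤s (⊆⇒size≤ us vs (λ {x} → h {suc x})))
⊆⇒≡⊎size< (false ∷ us) (false ∷ vs) h with ⊆⇒≡⊎size< us vs (λ {x} → h {suc x})
... | inj₁ us≡vs = inj₁ (cong (false ∷_) us≡vs)
... | inj₂ us<vs = inj₂ us<vs

module _ {n} (f : Vec Bool n → Vec Bool n) (inflationary : ∀ bs → ⟦ bs ⟧ ⊆ ⟦ f bs ⟧) where

  private
    fold-stable⊎large : ∀ bs k → f (fold bs f k) ≡ fold bs f k ⊎ k ≤ size (fold bs f k)
    fold-stable⊎large bs zero = inj₂ z≤n
    fold-stable⊎large bs (suc k) with fold-stable⊎large bs k
    ... | inj₁ stable = inj₁ (cong f stable)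
    ... | inj₂ large with ⊆⇒≡⊎size< (fold bs f k) (f (fold bs f k)) (inflationary _)
    ...   | inj₁ stable = inj₁ (cong f (sym stable))
    ...   | inj₂ grows  = inj₂ (≤-trans (s≤s large) grows)

  fold-fixpoint : ∀ bs → f (fold bs f (suc n)) ≡ fold bs f (suc n)
  fold-fixpoint bs with fold-stable⊎large bs (suc n)
  ... | inj₁ stable = stable
  ... | inj₂ large  = ⊥-elim (1+n≰n (≤-trans large (size≤length (fold bs f (suc n)))))

applyFin-mono : ∀ (F : FinOp) {X Y : Subset} → X ⊆ Y → applyFin F X ⊆ applyFin F Y
applyFin-mono F X⊆Y (D , m , D⊆X) = D , m , All.map X⊆Y D⊆X

applyFin? : ∀ (F : FinOp) {X : Subset} → Decidable X → Decidable (applyFin F X)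
applyFin? F {X} X? x = map′ fromAny toAny (any? (λ p → (proj₁ p ≟ x) ×-dec all? X? (proj₂ p)) F)
  where
  Fires : ℕ × List ℕ → Set
  Fires (y , D) = y ≡ x × All X D

  fromAny : Any Fires F → applyFin F X x
  fromAny a with find a
  ... | (_ , D) , m , refl , D⊆X = D , m , D⊆X

  toAny : applyFin F X x → Any Fires F
  toAny (D , m , D⊆X) = lose m (refl , D⊆X)

HOp-mono : ∀ (A : Approx) {X Y : Subset} → X ⊆ Y → HOp A X ⊆ HOp A Y
HOp-mono A X⊆Y (s , Fx) = s , applyFin-mono (A s) X⊆Y Fx

Increasing⇒mono : ∀ {A : Approx} → Increasing A → ∀ {t s} → t ≤′ s → ∀ {p} → p ∈ A t → p ∈ A s
Increasing⇒mono inc ≤′-refl        m = m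
Increasing⇒mono inc (≤′-step t≤s) m = inc _ _ (Increasing⇒mono inc t≤s m)

sublists : ∀ {A : Set} → List A → List (List A)
sublists []       = [] ∷ []
sublists (x ∷ xs) = map (x ∷_) (sublists xs) ++ sublists xs

filter∈sublists : ∀ {A : Set} {P : Pred A 0ℓ} (P? : Decidable P) xs → filter P? xs ∈ sublists xs
filter∈sublists P? []       = here refl
filter∈sublists P? (x ∷ xs) with does (P? x)
... | true  = ∈-++⁺ˡ (∈-map⁺ (x ∷_) (filter∈sublists P? xs))
... | false = ∈-++⁺ʳ _ (filter∈sublists P? xs)

sublists⊆ : ∀ {A : Set} {xs ys : List A} → ys ∈ sublists xs → All (_∈ xs) ys
sublists⊆ {xs = []}     (here refl) = []
sublists⊆ {xs = x ∷ xs} m with ∈-++⁻ (map (x ∷_) (sublists xs)) m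
... | inj₂ ys∈ = All.map there (sublists⊆ ys∈)
... | inj₁ ys∈ with ∈-map⁻ (x ∷_) ys∈
...   | _ , zs∈ , refl = here refl ∷ All.map there (sublists⊆ zs∈)

module _ (A : Approx) where

  data Closure (s : ℕ) (Y : Subset) : ℕ → Set where
    input : ∀ {x} → Y x → Closure s Y x
    rule  : ∀ {x} → x ≤ s → applyFin (A s) (Closure s Y) x → Closure s Y x

  Closed : ℕ → Subset → Set
  Closed s P = ∀ {x} → x ≤ s → applyFin (A s) P x → P x

  module _ {s} {Y P : Subset} (Y⊆P : Y ⊆ P) (P-closed : Closed s P) where
    mutual
      Closure-least : Closure s Y ⊆ P
      Closure-least (input y)              = Y⊆P y
      Closure-least (rule x≤s (D , m , a)) = P-closed x≤s (D , m , Closure-least-All a)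

      Closure-least-All : ∀ {D} → All (Closure s Y) D → All P D
      Closure-least-All []       = []
      Closure-least-All (c ∷ cs) = Closure-least c ∷ Closure-least-All cs

  Closure-mono : ∀ {s} {Y Z : Subset} → Y ⊆ Z → Closure s Y ⊆ Closure s Z
  Closure-mono Y⊆Z = Closure-least (input ∘ Y⊆Z) rule

  Closure-trans : ∀ {s} {Y Z : Subset} → Y ⊆ Closure s Z → Closure s Y ⊆ Closure s Z
  Closure-trans Y⊆ClZ = Closure-least Y⊆ClZ rule

  Closure-bounded : ∀ {s} {Y : Subset} → Y ⊆ (_≤ s) → Closure s Y ⊆ (_≤ s)
  Closure-bounded Y≤s = Closure-least Y≤s (λ x≤s _ → x≤s)

  Closure-suc : Increasing A → ∀ {s} {Y : Subset} → Closure s Y ⊆ Closure (suc s) Y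
  Closure-suc inc {s} = Closure-least input
    (λ x≤s (D , m , a) → rule (m≤n⇒m≤1+n x≤s) (D , inc s _ m , a))

  Closure⊆HOp : IsClosureOp (HOp A) → ∀ {s} {Y : Subset} → Closure s Y ⊆ HOp A Y
  Closure⊆HOp (extensive , idempotent) {s} {Y} =
    Closure-least (extensive Y) (λ _ (D , m , a) → idempotent Y (s , D , m , a))

  module _ (s : ℕ) {Y : Subset} (Y? : Decidable Y) where

    private
      round? : ∀ {n} (bs : Vec Bool n) → Decidable (⟦ bs ⟧ ∪ applyFin (A s) (Y ∪ ⟦ bs ⟧))
      round? bs = ⟦ bs ⟧? ∪? applyFin? (A s) (Y? ∪? ⟦ bs ⟧?)

      -- Opaque, since unfolding iterated rounds during conversion checking blows up.
      opaque
        closure-round : Vec Bool (suc s) → Vec Bool (suc s)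
        closure-round bs = characteristic (round? bs)

        closure-round⁺ : ∀ bs {x} → x ≤ s → (⟦ bs ⟧ ∪ applyFin (A s) (Y ∪ ⟦ bs ⟧)) x →
                         ⟦ closure-round bs ⟧ x
        closure-round⁺ bs x≤s = characteristic⁺ {suc s} (round? bs) (s≤s x≤s)

        closure-round⁻ : ∀ bs → ⟦ closure-round bs ⟧ ⊆ ⟦ bs ⟧ ∪ applyFin (A s) (Y ∪ ⟦ bs ⟧)
        closure-round⁻ bs = characteristic⁻ {suc s} (round? bs)

      closure-round-inflationary : ∀ bs → ⟦ bs ⟧ ⊆ ⟦ closure-round bs ⟧
      closure-round-inflationary bs x∈bs =
        closure-round⁺ bs (m<1+n⇒m≤n (⟦⟧-bounded bs x∈bs)) (inj₁ x∈bs)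

      closure-stage : ℕ → Vec Bool (suc s)
      closure-stage = fold (characteristic Y?) closure-round

      closure-stage⊆Closure : ∀ k → ⟦ closure-stage k ⟧ ⊆ Closure s Y
      closure-stage⊆Closure zero    x∈ = input (characteristic⁻ {suc s} Y? x∈)
      closure-stage⊆Closure (suc k) x∈ with closure-round⁻ (closure-stage k) x∈
      ... | inj₁ x∈stage       = closure-stage⊆Closure k x∈stage
      ... | inj₂ (D , m , D⊆) =
        rule (m<1+n⇒m≤n (⟦⟧-bounded (closure-stage (suc k)) x∈))
             (D , m , All.map [ input , closure-stage⊆Closure k ] D⊆)

      closure-bits : Vec Bool (suc s)
      closure-bits = closure-stage (suc (suc s))

      Closure⊆Y∪bits : Closure s Y ⊆ Y ∪ ⟦ closure-bits ⟧
      Closure⊆Y∪bits = Closure-least inj₁ λ {x} x≤s fires →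
        inj₂ (subst (λ bs → ⟦ bs ⟧ x)
                    (fold-fixpoint closure-round closure-round-inflationary (characteristic Y?))
                    (closure-round⁺ closure-bits x≤s (inj₂ fires)))

    closure? : Decidable (Closure s Y)
    closure? x = map′ [ input , closure-stage⊆Closure (suc (suc s)) ] Closure⊆Y∪bits
                      ((Y? ∪? ⟦ closure-bits ⟧?) x)

  Derives : ℕ → ℕ × List ℕ → Set
  Derives s (x , D) = Closure s (listSet D) x

  derives? : ∀ s → Decidable (Derives s)
  derives? s (x , D) = closure? s (_∈? D) x

  Â : Approx
  Â s = filter (derives? s) (cartesianProduct (downFrom (suc s)) (sublists (downFrom (suc s))))

  ∈-Â⁺ : ∀ s {x D} → x ∈ downFrom (suc s) → D ∈ sublists (downFrom (suc s)) →
         Closure s (listSet D) x → (x , D) ∈ Â s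
  ∈-Â⁺ s x∈ D∈ = ∈-filter⁺ (derives? s) (∈-cartesianProduct⁺ x∈ D∈)

  ∈-Â⁻ : ∀ s {x D} → (x , D) ∈ Â s →
         x ∈ downFrom (suc s) × D ∈ sublists (downFrom (suc s)) × Closure s (listSet D) x
  ∈-Â⁻ s m with ∈-filter⁻ (derives? s) m
  ... | m′ , derivation with ∈-cartesianProduct⁻ _ _ m′
  ...   | x∈ , D∈ = x∈ , D∈ , derivation

  Â-sound : ∀ s {x D} → (x , D) ∈ Â s → All (_≤ s) D × Closure s (listSet D) x
  Â-sound s m with ∈-Â⁻ s m
  ... | _ , D∈ , derivation = All.map (m<1+n⇒m≤n ∘ ∈-downFrom⁻) (sublists⊆ D∈) , derivation

  Â-complete : ∀ s {U x} → All (_≤ s) U → Closure s (listSet U) x → applyFin (Â s) (listSet U) x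
  Â-complete s {U} {x} U≤s derivation =
    D , ∈-Â⁺ s (∈-downFrom⁺ (s≤s x≤s)) (filter∈sublists (_∈? U) _) (Closure-mono U⊆D derivation)
      , All.tabulate (proj₂ ∘ ∈-filter⁻ (_∈? U))
    where
    D : List ℕ
    D = filter (_∈? U) (downFrom (suc s))

    U⊆D : listSet U ⊆ listSet D
    U⊆D y∈U = ∈-filter⁺ (_∈? U) (∈-downFrom⁺ (s≤s (All.lookup U≤s y∈U))) y∈U

    x≤s : x ≤ s
    x≤s = Closure-bounded (All.lookup U≤s) derivation

  Â-increasing : Increasing A → Increasing Â
  Â-increasing inc s (x , D) m with ∈-Â⁻ s m
  ... | x∈ , D∈ , derivation =
    ∈-Â⁺ (suc s) (there x∈) (∈-++⁺ʳ (map (suc s ∷_) (sublists (downFrom (suc s)))) D∈)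
         (Closure-suc inc derivation)

  Â-inflationary : ∀ s X → MaxLe X s → listSet X ⊆ applyFin (Â s) (listSet X)
  Â-inflationary s X X≤s x∈X = Â-complete s X≤s (input x∈X)

  Â-collect : ∀ {s} {X : Subset} {D} → All (applyFin (Â s) X) D →
              ∃[ U ] (All (_≤ s) U × U ⊆ᶠ X × All (Closure s (listSet U)) D)
  Â-collect []                          = [] , [] , [] , []
  Â-collect {s} ((E , m , E⊆X) ∷ rest) with Â-sound s m | Â-collect rest
  ... | E≤s , derivation | U , U≤s , U⊆X , derivations =
    E ++ U , ++⁺ E≤s U≤s , ++⁺ E⊆X U⊆X
           , Closure-mono ∈-++⁺ˡ derivation ∷ All.map (Closure-mono (∈-++⁺ʳ E)) derivations

  Â-idempotent : ∀ s X → applyFin (Â s) (applyFin (Â s) X) ⊆ applyFin (Â s) X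
  Â-idempotent s X (D , m , D⊆ÂX) with Â-collect D⊆ÂX
  ... | U , U≤s , U⊆X , derivations =
    applyFin-mono (Â s) (All.lookup U⊆X)
      (Â-complete s U≤s (Closure-trans (All.lookup derivations) (proj₂ (Â-sound s m))))

  HOp-Â⊆HOp : IsClosureOp (HOp A) → ∀ {X} → HOp Â X ⊆ HOp A X
  HOp-Â⊆HOp closure (s , D , m , D⊆X) =
    HOp-mono A (All.lookup D⊆X) (Closure⊆HOp closure (proj₂ (Â-sound s m)))

  HOp⊆HOp-Â : Increasing A → ∀ {X} → HOp A X ⊆ HOp Â X
  HOp⊆HOp-Â inc {x = x} (t , E , m , E⊆X) =
    s , applyFin-mono (Â s) (All.lookup E⊆X)
          (Â-complete s (xs≤max _ E) (rule x≤s (E , m′ , All.tabulate input)))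
    where
    s : ℕ
    s = max (x ⊔ t) E

    x≤s : x ≤ s
    x≤s = ≤-trans (m≤m⊔n x t) (⊥≤max _ E)

    m′ : (x , E) ∈ A s
    m′ = Increasing⇒mono inc (≤⇒≤′ (≤-trans (m≤n⊔m x t) (⊥≤max _ E))) m

lemma1p11 : (A : Approx) → Increasing A → IsClosureOp (HOp A) →
    Σ Approx (λ Â →
      Increasing Â
      × (∀ (s : ℕ) (X : List ℕ) → MaxLe X s →
           listSet X ⊆ applyFin (Â s) (listSet X))
      × (∀ (s : ℕ) (X : Subset) →
           applyFin (Â s) (applyFin (Â s) X) ⊆ applyFin (Â s) X)
      × (∀ (X : Subset) → HOp Â X ≐ HOp A X))
lemma1p11 A inc closure =
  Â A , Â-increasing A inc , Â-inflationary A , Â-idempotent A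
      , λ X → HOp-Â⊆HOp A closure , HOp⊆HOp-Â A inc
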